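{- Let $N\ge 0$ be an integer. The CVT-XOR Tree with root $(0,N)$ has exactly $N+1$ nodes; that is, every pair $(X,Y)$ of non-negative integers with $X+Y=N$ belongs to it.
   Context: For non-negative integers $X,Y$ written in binary, $\mathrm{XOR}(X,Y)$ is their bitwise exclusive or, and the Carry Value Transformation is $\mathrm{CVT}(X,Y)=2\cdot(X \mathbin{\mathrm{AND}} Y)$, i.e. the bitwise AND shifted one position to the left with a $0$ appended as least significant bit. Define $f(X,Y)=(\mathrm{CVT}(X,Y),\mathrm{XOR}(X,Y))$; then $X+Y=\mathrm{CVT}(X,Y)+\mathrm{XOR}(X,Y)$. For an integer $N\ge 0$, the CVT-XOR Tree with root $(0,N)$ has as nodes pairs $(X,Y)$ of non-negative integers with $X+Y=N$; the root is $(0,N)$ (which satisfies $f(0,N)=(0,N)$, a self-loop), and a pair $(X,Y)$ is a node if iterating $f$ from $(X,Y)$ eventually reaches $(0,N)$, in which case the parent of a non-root node $(X,Y)$ is $f(X,Y)$. -}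

module Defs where

open import Data.Nat using (ℕ; zero; suc; _+_; _*_)
open import Data.Nat.DivMod using (_/_; _%_)
open import Data.Product using (_×_; _,_)

-- Bitwise operations on ℕ, computed digit by digit in binary.
-- 'fuel' bounds the number of binary digits processed; fuel ≥ x + y
-- suffices since each step halves both arguments.
andF : ℕ → ℕ → ℕ → ℕ
andF zero    x y = 0
andF (suc k) x y = andBit (x % 2) (y % 2) + 2 * andF k (x / 2) (y / 2)
  where
  andBit : ℕ → ℕ → ℕ
  andBit 1 1 = 1
  andBit _ _ = 0

xorF : ℕ → ℕ → ℕ → ℕ
xorF zero    x y = 0
xorF (suc k) x y = xorBit (x % 2) (y % 2) + 2 * xorF k (x / 2) (y / 2)
  where
  xorBit : ℕ → ℕ → ℕ
  xorBit 1 0 = 1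
  xorBit 0 1 = 1
  xorBit _ _ = 0

AND : ℕ → ℕ → ℕ
AND x y = andF (x + y) x y

XOR : ℕ → ℕ → ℕ
XOR x y = xorF (x + y) x y

CVT : ℕ → ℕ → ℕ
CVT x y = 2 * AND x y

f : ℕ × ℕ → ℕ × ℕ
f (x , y) = (CVT x y , XOR x y)

iter : ℕ → ℕ × ℕ → ℕ × ℕ
iter zero    p = p
iter (suc k) p = iter k (f p)

module Submission where

-- Two invariants of f drive the proof.
--   * Sum: CVT x y + XOR x y ≡ x + y, the carry-save form of binary addition.
--     It follows digit by digit from the half-adder identity
--     2·(a AND b) + (a XOR b) ≡ a + b on bits, by induction on the fuel
--     of the digit-recursive definitions andF / xorF.
--   * Trailing zeros: if 2^j divides x then 2^j divides x AND y, so
--     2^(j+1) divides CVT x y.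
-- Iterating, after k steps the first component is divisible by 2^k while
-- the sum stays N.  For k = N the first component is a multiple of 2^N
-- that is at most N < 2^N, hence 0, and the second component is N.

open import Defs
open import Data.Nat using (ℕ; _+_)
open import Data.Product using (_×_; _,_; ∃)
open import Relation.Binary.PropositionalEquality using (_≡_)

open import Data.Nat using (zero; suc; _*_; _^_; _≤_; _<_; z≤n; s≤s)
open import Data.Nat.Properties
open import Data.Nat.DivMod using (_/_; _%_; m%n<n; m≡m%n+[m/n]*n; m*n%n≡0; m*n/n≡m)
open import Data.Nat.Divisibility using (_∣_; divides; _∣0; 1∣_; *-monoʳ-∣; ∣⇒≤)
open import Data.Product using (proj₁; proj₂)
open import Relation.Binary.PropositionalEquality
  using (refl; sym; trans; cong; cong₂; subst; module ≡-Reasoning)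
open import Relation.Nullary using (contradiction)
open import Data.Nat.Solver using (module +-*-Solver)
open +-*-Solver using (solve; _:+_; _:*_; con; _:=_)

digit<2 : ∀ x → x % 2 < 2
digit<2 x = m%n<n x 2

binary-split : ∀ x → x ≡ x % 2 + 2 * (x / 2)
binary-split x = trans (m≡m%n+[m/n]*n x 2) (cong (x % 2 +_) (*-comm (x / 2) 2))

double-half≤ : ∀ x → 2 * (x / 2) ≤ x
double-half≤ x = subst (2 * (x / 2) ≤_) (sym (binary-split x)) (m≤n+m (2 * (x / 2)) (x % 2))

andDigit : ℕ → ℕ → ℕ
andDigit 1 1 = 1
andDigit _ _ = 0

xorDigit : ℕ → ℕ → ℕ
xorDigit 1 0 = 1
xorDigit 0 1 = 1
xorDigit _ _ = 0

andF-step : ∀ k x y → andF (suc k) x y ≡ andDigit (x % 2) (y % 2) + 2 * andF k (x / 2) (y / 2)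
andF-step k x y with x % 2 | y % 2 | digit<2 x | digit<2 y
... | 0 | 0 | _ | _ = refl
... | 0 | 1 | _ | _ = refl
... | 1 | 0 | _ | _ = refl
... | 1 | 1 | _ | _ = refl
... | suc (suc _) | _ | s≤s (s≤s ()) | _
... | _ | suc (suc _) | _ | s≤s (s≤s ())

xorF-step : ∀ k x y → xorF (suc k) x y ≡ xorDigit (x % 2) (y % 2) + 2 * xorF k (x / 2) (y / 2)
xorF-step k x y with x % 2 | y % 2 | digit<2 x | digit<2 y
... | 0 | 0 | _ | _ = refl
... | 0 | 1 | _ | _ = refl
... | 1 | 0 | _ | _ = refl
... | 1 | 1 | _ | _ = refl
... | suc (suc _) | _ | s≤s (s≤s ()) | _
... | _ | suc (suc _) | _ | s≤s (s≤s ())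

half-adder : ∀ a b → a < 2 → b < 2 → 2 * andDigit a b + xorDigit a b ≡ a + b
half-adder 0 0 _ _ = refl
half-adder 0 1 _ _ = refl
half-adder 1 0 _ _ = refl
half-adder 1 1 _ _ = refl
half-adder (suc (suc _)) _ (s≤s (s≤s ())) _
half-adder _ (suc (suc _)) _ (s≤s (s≤s ()))

double≤suc⇒≤ : ∀ m k → 2 * m ≤ suc k → m ≤ k
double≤suc⇒≤ zero    k _ = z≤n
double≤suc⇒≤ (suc m) k h = <⇒≤pred (<-≤-trans (m<m+n (suc m) {suc m + 0} (s≤s z≤n)) h)

-- Fuel k + 1 covering x + y leaves fuel k covering the halved arguments,
-- so the digit recursion never runs out of fuel.
halves-fit : ∀ k x y → x + y ≤ suc k → x / 2 + y / 2 ≤ k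
halves-fit k x y h = double≤suc⇒≤ (x / 2 + y / 2) k (begin
  2 * (x / 2 + y / 2)           ≡⟨ *-distribˡ-+ 2 (x / 2) (y / 2) ⟩
  2 * (x / 2) + 2 * (y / 2)     ≤⟨ +-mono-≤ (double-half≤ x) (double-half≤ y) ⟩
  x + y                         ≤⟨ h ⟩
  suc k                         ∎)
  where open ≤-Reasoning

carry-save : ∀ k x y → x + y ≤ k → 2 * andF k x y + xorF k x y ≡ x + y
carry-save zero    zero    zero    _ = refl
carry-save zero    (suc x) y       ()
carry-save zero    zero    (suc y) ()
carry-save (suc k) x y h = begin
    2 * andF (suc k) x y + xorF (suc k) x y
  ≡⟨ cong₂ (λ u v → 2 * u + v) (andF-step k x y) (xorF-step k x y) ⟩
    2 * (a + 2 * A) + (b + 2 * B)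
  ≡⟨ solve 4 (λ a A b B → con 2 :* (a :+ con 2 :* A) :+ (b :+ con 2 :* B)
                       := (con 2 :* a :+ b) :+ con 2 :* (con 2 :* A :+ B)) refl a A b B ⟩
    (2 * a + b) + 2 * (2 * A + B)
  ≡⟨ cong₂ (λ u v → u + 2 * v) (half-adder (x % 2) (y % 2) (digit<2 x) (digit<2 y))
                                (carry-save k (x / 2) (y / 2) (halves-fit k x y h)) ⟩
    (x % 2 + y % 2) + 2 * (x / 2 + y / 2)
  ≡⟨ solve 4 (λ p q r s → (p :+ q) :+ con 2 :* (r :+ s)
                       := (p :+ con 2 :* r) :+ (q :+ con 2 :* s)) refl (x % 2) (y % 2) (x / 2) (y / 2) ⟩
    (x % 2 + 2 * (x / 2)) + (y % 2 + 2 * (y / 2))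
  ≡⟨ sym (cong₂ _+_ (binary-split x) (binary-split y)) ⟩
    x + y ∎
  where
  open ≡-Reasoning
  a = andDigit (x % 2) (y % 2)
  b = xorDigit (x % 2) (y % 2)
  A = andF k (x / 2) (y / 2)
  B = xorF k (x / 2) (y / 2)

cvt-xor-sum : ∀ x y → CVT x y + XOR x y ≡ x + y
cvt-xor-sum x y = carry-save (x + y) x y ≤-refl

iter-sum : ∀ k x y → proj₁ (iter k (x , y)) + proj₂ (iter k (x , y)) ≡ x + y
iter-sum zero    x y = refl
iter-sum (suc k) x y = trans (iter-sum k (CVT x y) (XOR x y)) (cvt-xor-sum x y)

halve-multiple : ∀ j x → 2 ^ suc j ∣ x → (x % 2 ≡ 0) × (2 ^ j ∣ x / 2)
halve-multiple j x (divides q refl) =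
  trans (cong (_% 2) regroup) (m*n%n≡0 (q * 2 ^ j) 2) ,
  divides q (trans (cong (_/ 2) regroup) (m*n/n≡m (q * 2 ^ j) 2))
  where
  regroup : q * (2 * 2 ^ j) ≡ (q * 2 ^ j) * 2
  regroup = trans (cong (q *_) (*-comm 2 (2 ^ j))) (sym (*-assoc q (2 ^ j) 2))

and-divisible : ∀ k j x y → 2 ^ j ∣ x → 2 ^ j ∣ andF k x y
and-divisible zero    j       x y _ = _ ∣0
and-divisible (suc k) zero    x y _ = 1∣ _
and-divisible (suc k) (suc j) x y d =
  subst (2 ^ suc j ∣_) (sym unfold) (*-monoʳ-∣ 2 (and-divisible k j (x / 2) (y / 2) (proj₂ halved)))
  where
  halved : (x % 2 ≡ 0) × (2 ^ j ∣ x / 2)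
  halved = halve-multiple j x d
  unfold : andF (suc k) x y ≡ 2 * andF k (x / 2) (y / 2)
  unfold = trans (andF-step k x y)
                 (cong (λ t → andDigit t (y % 2) + 2 * andF k (x / 2) (y / 2)) (proj₁ halved))

iter-divisible : ∀ k j x y → 2 ^ j ∣ x → 2 ^ (j + k) ∣ proj₁ (iter k (x , y))
iter-divisible zero    j x y d = subst (λ e → 2 ^ e ∣ x) (sym (+-identityʳ j)) d
iter-divisible (suc k) j x y d =
  subst (λ e → 2 ^ e ∣ proj₁ (iter k (CVT x y , XOR x y))) (sym (+-suc j k))
    (iter-divisible k (suc j) (CVT x y) (XOR x y) (*-monoʳ-∣ 2 (and-divisible (x + y) j x y d)))

n<2^n : ∀ n → n < 2 ^ n
n<2^n zero    = s≤s z≤n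
n<2^n (suc n) = +-mono-≤-< (m^n>0 2 n) (≤-trans (n<2^n n) (m≤m+n (2 ^ n) 0))

multiple-below⇒zero : ∀ m a → a < m → m ∣ a → a ≡ 0
multiple-below⇒zero m zero    _   _ = refl
multiple-below⇒zero m (suc a) a<m d = contradiction (∣⇒≤ d) (<⇒≱ a<m)

theorem1 : (N X Y : ℕ) → X + Y ≡ N → ∃ λ k → iter k (X , Y) ≡ (0 , N)
theorem1 N X Y sum≡N = N , cong₂ _,_ first≡0 second≡N
  where
  a b : ℕ
  a = proj₁ (iter N (X , Y))
  b = proj₂ (iter N (X , Y))
  a+b≡N : a + b ≡ N
  a+b≡N = trans (iter-sum N X Y) sum≡N
  first≡0 : a ≡ 0
  first≡0 = multiple-below⇒zero (2 ^ N) a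
    (≤-<-trans (subst (a ≤_) a+b≡N (m≤m+n a b)) (n<2^n N))
    (iter-divisible N 0 X Y (1∣ X))
  second≡N : b ≡ N
  second≡N = trans (sym (cong (_+ b) first≡0)) a+b≡N
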